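{- Let $\delta,K_1,K_2,C_0,C_1$ be admissible parameters and $M$ a magic parameter. Let $\mathbf{G}=(G,E,d)$ be a finite $\delta$-edge-labelled graph which has a completion in $\mathcal{A}^\delta_{K_1,K_2,C_0,C_1}$. Let $\bar{\mathbf{G}}=(G,\bar d)$ be the completion of $\mathbf{G}$ with magic parameter $M$, and let $\mathbf{G}'=(G,d')\in\mathcal{A}^\delta_{K_1,K_2,C_0,C_1}$ be an arbitrary completion of $\mathbf{G}$. Then for every pair of vertices $u,v\in G$ one of the following holds: (1) $d'(u,v)\ge\bar d(u,v)\ge M$; (2) $d'(u,v)\le\bar d(u,v)\le M$; (3) the parameters satisfy Case (IIB), $\bar d(u,v)=M-1$, $d'(u,v)>M$, and $d'(u,v)$ has the same parity as $\bar d(u,v)$.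
   Context: A $\delta$-edge-labelled graph is $(V,E,d)$ with $(V,E)$ a simple graph and $d:E\to\{1,\dots,\delta\}$; a completion of it into a class $\mathcal{K}$ of metric spaces with distances in $\{0,\dots,\delta\}$ is $(V,d')\in\mathcal{K}$ with $d'|_E=d$. Parameters $\delta,K_1,K_2,C_0,C_1$ are positive integers; acceptable if $3\le\delta<\infty$, $1\le K_1\le K_2\le\delta$, $2\delta+2\le C_0,C_1\le 3\delta+2$, $C_0$ even, $C_1$ odd. $C=\min(C_0,C_1)$, $C'=\max(C_0,C_1)$. Admissible: acceptable and either (II) $C\le 2\delta+K_1$, $C=2K_1+2K_2+1$, $K_1+K_2\ge\delta$, $K_1+2K_2\le 2\delta-1$, and either (IIA) $C'=C+1$ or (IIB) $C'>C+1$, $K_1=K_2$, $3K_2=2\delta-1$; or (III) $C\ge 2\delta+K_1+1$, $K_1+2K_2\ge 2\delta-1$, $3K_2\ge 2\delta$, if $K_1+2K_2=2\delta-1$ then $C\ge 2\delta+K_1+2$, and if $C'>C+1$ then $C\ge 2\delta+K_2$. $\mathcal{A}^\delta_{K_1,K_2,C_0,C_1}$: finite metric spaces with distances in $\{0,\dots,\delta\}$ such that for every three distinct points with perimeter $p$ and smallest distance $m$: if $p$ odd then $2K_1<p$, $p<2K_2+2m$, $p<C_1$; if $p$ even then $p<C_0$. A magic distance is $M$ with $\max(K_1,\lceil\delta/2\rceil)\le M\le\min(K_2,\lfloor(C-\delta-1)/2\rfloor)$; a magic parameter is a magic distance such that additionally: if Case (III) holds and $K_1+2K_2=2\delta-1$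 then $M>K_1$; if Case (III) holds, $C'>C+1$ and $C=2\delta+K_2$, then $M<K_2$. For $x\in\{1,\dots,\delta\}\setminus\{M\}$: $\mathcal{F}^+_x=\{(a,b)\in\{1,\dots,\delta\}^2:a+b=x\}$, $\mathcal{F}^-_x=\{(a,b):|a-b|=x\}$, $\mathcal{F}^C_x=\{(a,b):C-1-a-b=x\}$; $\mathbb{F}_M(x)=\mathcal{F}^+_x\cup\mathcal{F}^C_x$ if $x<M$, $\mathcal{F}^-_x$ if $x>M$; $t_M(x)=2x-1$ if $x<M$, $2(\delta-x)$ if $x>M$. For $\mathcal{F}\subseteq\{1,\dots,\delta\}^2$, $c$, and $\mathbf{H}=(V,E,d)$, the $(\mathcal{F},c)$-completion of $\mathbf{H}$ is the $\delta$-edge-labelled graph on $V$ whose edges are those of $\mathbf{H}$ with their labels together with every non-edge $uv$ for which there is $w$ with $uw,vw\in E$ and $(d(u,w),d(v,w))\in\mathcal{F}$, labelled $c$. The completion of $\mathbf{G}$ with magic parameter $M$: $\mathbf{G}_1=\mathbf{G}$; for $k\ge1$, $\mathbf{G}_{k+1}=\mathbf{G}_k$ if $k$ is not in the image of $t_M$, otherwise $\mathbf{G}_{k+1}$ is the $(\mathbb{F}_M(t_M^{ -1}(k)),t_M^{ -1}(k))$-completion of $\mathbf{G}_k$; in the eventual limit every remaining non-edge is labelled $M$, giving $\bar{\mathbf{G}}=(V,\bar d)$. -}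

module Defs where

open import Data.Nat using (ℕ; zero; suc; _+_; _*_; _∸_; _≤_; _<_; _⊓_; _⊔_; _≡ᵇ_; _<ᵇ_; _≤ᵇ_; ⌈_/2⌉; ⌊_/2⌋)
open import Data.Nat.DivMod using (_%_)
open import Data.Fin using (Fin; _≟_)
open import Data.Bool using (Bool; true; false; _∧_; _∨_; not; if_then_else_)
open import Data.Maybe using (Maybe; just; nothing)
open import Data.List using (List; allFin; map; upTo; foldr)
open import Data.Bool.ListAction using (any)
open import Data.Product using (_×_; Σ)
open import Data.Sum using (_⊎_)
open import Relation.Binary.PropositionalEquality using (_≡_; _≢_)
open import Relation.Nullary.Decidable using (⌊_⌋)

Cmin : ℕ → ℕ → ℕ
Cmin C₀ C₁ = C₀ ⊓ C₁

Cmax : ℕ → ℕ → ℕ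
Cmax C₀ C₁ = C₀ ⊔ C₁

Acceptable : (δ K₁ K₂ C₀ C₁ : ℕ) → Set
Acceptable δ K₁ K₂ C₀ C₁ =
  3 ≤ δ × 1 ≤ K₁ × K₁ ≤ K₂ × K₂ ≤ δ ×
  2 * δ + 2 ≤ C₀ × C₀ ≤ 3 * δ + 2 ×
  2 * δ + 2 ≤ C₁ × C₁ ≤ 3 * δ + 2 ×
  C₀ % 2 ≡ 0 × C₁ % 2 ≡ 1

CaseIIcore : (δ K₁ K₂ C₀ C₁ : ℕ) → Set
CaseIIcore δ K₁ K₂ C₀ C₁ =
  Cmin C₀ C₁ ≤ 2 * δ + K₁ × Cmin C₀ C₁ ≡ 2 * K₁ + 2 * K₂ + 1 ×
  δ ≤ K₁ + K₂ × K₁ + 2 * K₂ ≤ 2 * δ ∸ 1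

CaseIIA : (δ K₁ K₂ C₀ C₁ : ℕ) → Set
CaseIIA δ K₁ K₂ C₀ C₁ =
  CaseIIcore δ K₁ K₂ C₀ C₁ × Cmax C₀ C₁ ≡ Cmin C₀ C₁ + 1

CaseIIB : (δ K₁ K₂ C₀ C₁ : ℕ) → Set
CaseIIB δ K₁ K₂ C₀ C₁ =
  CaseIIcore δ K₁ K₂ C₀ C₁ ×
  Cmin C₀ C₁ + 1 < Cmax C₀ C₁ × K₁ ≡ K₂ × 3 * K₂ ≡ 2 * δ ∸ 1

CaseII : (δ K₁ K₂ C₀ C₁ : ℕ) → Set
CaseII δ K₁ K₂ C₀ C₁ = CaseIIA δ K₁ K₂ C₀ C₁ ⊎ CaseIIB δ K₁ K₂ C₀ C₁

CaseIII : (δ K₁ K₂ C₀ C₁ : ℕ) → Set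
CaseIII δ K₁ K₂ C₀ C₁ =
  2 * δ + K₁ + 1 ≤ Cmin C₀ C₁ ×
  2 * δ ∸ 1 ≤ K₁ + 2 * K₂ ×
  2 * δ ≤ 3 * K₂ ×
  (K₁ + 2 * K₂ ≡ 2 * δ ∸ 1 → 2 * δ + K₁ + 2 ≤ Cmin C₀ C₁) ×
  (Cmin C₀ C₁ + 1 < Cmax C₀ C₁ → 2 * δ + K₂ ≤ Cmin C₀ C₁)

Admissible : (δ K₁ K₂ C₀ C₁ : ℕ) → Set
Admissible δ K₁ K₂ C₀ C₁ =
  Acceptable δ K₁ K₂ C₀ C₁ × (CaseII δ K₁ K₂ C₀ C₁ ⊎ CaseIII δ K₁ K₂ C₀ C₁)

MagicDistance : (δ K₁ K₂ C₀ C₁ M : ℕ) → Set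
MagicDistance δ K₁ K₂ C₀ C₁ M =
  (K₁ ⊔ ⌈ δ /2⌉) ≤ M × M ≤ (K₂ ⊓ ⌊ (Cmin C₀ C₁ ∸ δ ∸ 1) /2⌋)

MagicParameter : (δ K₁ K₂ C₀ C₁ M : ℕ) → Set
MagicParameter δ K₁ K₂ C₀ C₁ M =
  MagicDistance δ K₁ K₂ C₀ C₁ M ×
  (CaseIII δ K₁ K₂ C₀ C₁ → K₁ + 2 * K₂ ≡ 2 * δ ∸ 1 → K₁ < M) ×
  (CaseIII δ K₁ K₂ C₀ C₁ → Cmin C₀ C₁ + 1 < Cmax C₀ C₁ →
     Cmin C₀ C₁ ≡ 2 * δ + K₂ → M < K₂)

-- δ-edge-labelled graphs on the vertex set Fin n.
-- lab u v ≡ just l  means uv is an edge with label l; nothing = non-edge.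

Lab : ℕ → Set
Lab n = Fin n → Fin n → Maybe ℕ

record ELGraph (δ n : ℕ) : Set where
  field
    lab    : Lab n
    loopless : ∀ u → lab u u ≡ nothing
    symm   : ∀ u v → lab u v ≡ lab v u
    range  : ∀ u v l → lab u v ≡ just l → 1 ≤ l × l ≤ δ
open ELGraph public

record IsMetricδ (δ n : ℕ) (d : Fin n → Fin n → ℕ) : Set where
  field
    zero⇒eq : ∀ u v → d u v ≡ 0 → u ≡ v
    eq⇒zero : ∀ u → d u u ≡ 0
    symm    : ∀ u v → d u v ≡ d v u
    triangle : ∀ u v w → d u w ≤ d u v + d v w
    bounded : ∀ u v → d u v ≤ δ

InA : (δ K₁ K₂ C₀ C₁ n : ℕ) → (Fin n → Fin n → ℕ) → Set
InA δ K₁ K₂ C₀ C₁ n d =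
  IsMetricδ δ n d ×
  (∀ u v w → u ≢ v → v ≢ w → u ≢ w →
    let p = d u v + d v w + d u w
        m = d u v ⊓ d v w ⊓ d u w
    in (p % 2 ≡ 1 → 2 * K₁ < p × p < 2 * K₂ + 2 * m × p < C₁) ×
       (p % 2 ≡ 0 → p < C₀))

Extends : ∀ {δ n} → ELGraph δ n → (Fin n → Fin n → ℕ) → Set
Extends {n = n} G d′ = ∀ (u v : Fin n) l → lab G u v ≡ just l → d′ u v ≡ l

CompletionInA : (δ K₁ K₂ C₀ C₁ n : ℕ) → ELGraph δ n → (Fin n → Fin n → ℕ) → Set
CompletionInA δ K₁ K₂ C₀ C₁ n G d′ = InA δ K₁ K₂ C₀ C₁ n d′ × Extends G d′

pairOK : (ℕ → ℕ → Bool) → Maybe ℕ → Maybe ℕ → Bool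
pairOK F (just a) (just b) = F a b
pairOK F _ _ = false

FCompletion : ∀ {n} → (ℕ → ℕ → Bool) → ℕ → Lab n → Lab n
FCompletion {n} F c l u v with l u v
... | just a = just a
... | nothing =
  if not ⌊ u ≟ v ⌋ ∧ any (λ w → pairOK F (l u w) (l v w)) (allFin n)
  then just c else nothing

inRangeᵇ : ℕ → ℕ → Bool
inRangeᵇ δ a = (1 ≤ᵇ a) ∧ (a ≤ᵇ δ)

-- 𝔽_M(x): F⁺_x ∪ F^C_x if x < M, F⁻_x if x > M
-- ((a,b) ∈ F^C_x iff C-1-a-b = x, i.e. a+b+x = C-1 as C-1-a-b is an integer)
𝔽 : (δ C M x : ℕ) → ℕ → ℕ → Bool
𝔽 δ C M x a b =
  inRangeᵇ δ a ∧ inRangeᵇ δ b ∧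
  (if x <ᵇ M
   then ((a + b ≡ᵇ x) ∨ (a + b + x ≡ᵇ C ∸ 1))
   else ((a ≡ᵇ b + x) ∨ (b ≡ᵇ a + x)))

tM : (δ M x : ℕ) → ℕ
tM δ M x = if x <ᵇ M then 2 * x ∸ 1 else 2 * (δ ∸ x)

-- step k: if k = t_M(x) for some x ∈ {1,…,δ}∖{M}, apply the
-- (𝔽_M(x),x)-completion; otherwise do nothing.  (t_M is injective
-- on {1,…,δ}∖{M}, so at most one x matches.)
step : ∀ {n} → (δ C M k : ℕ) → Lab n → Lab n
step δ C M k l =
  foldr (λ x acc → if not (x ≡ᵇ M) ∧ (tM δ M x ≡ᵇ k)
                   then FCompletion (𝔽 δ C M x) x acc else acc)
        l (map suc (upTo δ))

-- Gseq j = 𝐆_{j+1}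
Gseq : ∀ {n} → (δ C M : ℕ) → Lab n → ℕ → Lab n
Gseq δ C M l zero = l
Gseq δ C M l (suc j) = step δ C M (suc j) (Gseq δ C M l j)

-- the limit: all values of t_M are ≤ 2δ-1, so 𝐆_k = 𝐆_{2δ+1} for all k ≥ 2δ+1.
-- Remaining non-edges (u ≠ v) get distance M; d̄(u,u) = 0.
magicCompletion : ∀ {δ n} → (C₀ C₁ M : ℕ) → ELGraph δ n → Fin n → Fin n → ℕ
magicCompletion {δ} C₀ C₁ M G u v
  with Gseq δ (Cmin C₀ C₁) M (lab G) (2 * δ) u v
... | just l = l
... | nothing = if ⌊ u ≟ v ⌋ then 0 else M

{-# OPTIONS --safe #-}
-- Each label that the magic completion creates is compared with d′ by induction along the
-- completion procedure. A label x < M comes either from two edges with a + b = x, whose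
-- labels are below M - 1 and so bound d′ from above, or from two long edges with
-- a + b + x = C - 1, where d′ > x would make the perimeter reach C, which the parity bounds
-- permit only in Case (IIB), with x = M - 1 and d′ of the parity of x. A label x > M comes
-- from a long edge a and a short edge b with a - b = x, which bound d′ from below.
-- Pairs that stay unlabelled get M itself.
module Submission where

open import Defs
open import Data.Bool.Base using (true; false; T; _∧_; not; if_then_else_)
open import Data.Bool.ListAction using (any)
open import Data.Bool.Properties using (T-∧; T-∨)
open import Data.Empty using (⊥-elim)
open import Data.Fin using (Fin; _≟_)
open import Data.List.Base using ([]; _∷_; foldr; map; upTo; allFin)
open import Data.List.Relation.Unary.Any using (satisfied)
open import Data.List.Relation.Unary.Any.Properties using (any⁻)
open import Data.Maybe.Base using (just; nothing)
open import Data.Nat.Base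
  using (ℕ; zero; suc; _+_; _*_; _∸_; _≤_; _<_; _≥_; _≰_; _≡ᵇ_; _<ᵇ_; ⌈_/2⌉; ⌊_/2⌋; z≤n; s≤s)
open import Data.Nat.DivMod using (_%_; [m+kn]%n≡m%n)
open import Data.Nat.Properties hiding (_≟_)
open import Data.Nat.Tactic.RingSolver using (solve-∀)
open import Data.Product using (_×_; Σ; ∃; ∃₂; _,_; proj₁; proj₂)
open import Data.Sum using (_⊎_; inj₁; inj₂; [_,_]′)
open import Data.Unit.Base using (tt)
open import Function.Base using (_∘_)
open import Function.Bundles using (Equivalence)
open import Relation.Binary.PropositionalEquality
  using (_≡_; _≢_; refl; sym; trans; cong; cong₂; subst)
open import Relation.Nullary using (yes; no; contradiction)
open import Relation.Nullary.Reflects using (ofʸ; ofⁿ)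

%2-dichotomy : ∀ n → n % 2 ≡ 0 ⊎ n % 2 ≡ 1
%2-dichotomy zero          = inj₁ refl
%2-dichotomy (suc zero)    = inj₂ refl
%2-dichotomy (suc (suc n)) = %2-dichotomy n

%2-suc≢ : ∀ n → suc n % 2 ≢ n % 2
%2-suc≢ zero          ()
%2-suc≢ (suc zero)    ()
%2-suc≢ (suc (suc n)) = %2-suc≢ n

%2≢suc%2⇒≡ : ∀ m n → m % 2 ≢ suc n % 2 → m % 2 ≡ n % 2
%2≢suc%2⇒≡ (suc (suc m)) n             m≢1+n = %2≢suc%2⇒≡ m n m≢1+n
%2≢suc%2⇒≡ m             (suc (suc n)) m≢1+n = %2≢suc%2⇒≡ m n m≢1+n
%2≢suc%2⇒≡ zero          zero          _     = refl
%2≢suc%2⇒≡ zero          (suc zero)    m≢1+n = contradiction refl m≢1+n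
%2≢suc%2⇒≡ (suc zero)    zero          m≢1+n = contradiction refl m≢1+n
%2≢suc%2⇒≡ (suc zero)    (suc zero)    _     = refl

[m+n+n]%2≡m%2 : ∀ m n → (m + n + n) % 2 ≡ m % 2
[m+n+n]%2≡m%2 m n = trans (cong (_% 2) (shape m n)) ([m+kn]%n≡m%n m n 2)
  where
  shape : ∀ m n → m + n + n ≡ m + n * 2
  shape = solve-∀

parity-gap : ∀ {c p c′} → c ≤ p → p < c′ → p % 2 ≢ c % 2 → c + 1 < c′
parity-gap {c} {p} {c′} c≤p p<c′ p≢c = subst (_< c′) (+-comm 1 c)
  (≤-<-trans (≤∧≢⇒< c≤p (λ c≡p → p≢c (cong (_% 2) (sym c≡p)))) p<c′)

perimeter-gap : ∀ {C₀ C₁ p} → C₀ % 2 ≡ 0 → C₁ % 2 ≡ 1 → Cmin C₀ C₁ ≤ p →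
  (p % 2 ≡ 1 → p < C₁) → (p % 2 ≡ 0 → p < C₀) →
  Cmin C₀ C₁ + 1 < Cmax C₀ C₁ × p % 2 ≢ Cmin C₀ C₁ % 2
perimeter-gap {C₀} {C₁} {p} C₀-even C₁-odd C≤p odd⇒ even⇒ with ≤-total C₀ C₁ | %2-dichotomy p
... | inj₁ C₀≤C₁ | inj₁ p-even =
  ⊥-elim (<⇒≱ (even⇒ p-even) (subst (_≤ p) (m≤n⇒m⊓n≡m C₀≤C₁) C≤p))
... | inj₂ C₁≤C₀ | inj₂ p-odd =
  ⊥-elim (<⇒≱ (odd⇒ p-odd) (subst (_≤ p) (m≥n⇒m⊓n≡n C₁≤C₀) C≤p))
... | inj₁ C₀≤C₁ | inj₂ p-odd rewrite m≤n⇒m⊓n≡m C₀≤C₁ | m≤n⇒m⊔n≡n C₀≤C₁ =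
  parity-gap C≤p (odd⇒ p-odd) p≢C₀ , p≢C₀
  where
  p≢C₀ : p % 2 ≢ C₀ % 2
  p≢C₀ p≡C₀ = contradiction (trans (sym p-odd) (trans p≡C₀ C₀-even)) (λ ())
... | inj₂ C₁≤C₀ | inj₁ p-even rewrite m≥n⇒m⊓n≡n C₁≤C₀ | m≥n⇒m⊔n≡m C₁≤C₀ =
  parity-gap C≤p (even⇒ p-even) p≢C₁ , p≢C₁
  where
  p≢C₁ : p % 2 ≢ C₁ % 2
  p≢C₁ p≡C₁ = contradiction (trans (sym p-even) (trans p≡C₁ C₁-odd)) (λ ())

m+n≡o+o⇒m≡o : ∀ {m n o} → m ≤ o → n ≤ o → m + n ≡ o + o → m ≡ o
m+n≡o+o⇒m≡o {m} {n} {o} m≤o n≤o m+n≡o+o = ≤-antisym m≤o (+-cancelʳ-≤ o o m (begin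
  o + o ≡⟨ sym m+n≡o+o ⟩
  m + n ≤⟨ +-monoʳ-≤ m n≤o ⟩
  m + o ∎))
  where open ≤-Reasoning

-- The constructors correspond to 𝓕⁺_x, 𝓕^C_x and the two halves of 𝓕⁻_x.
data 𝔽-View (δ C M x a b : ℕ) : Set where
  sum         : x < M → 1 ≤ a → 1 ≤ b → a + b ≡ x → 𝔽-View δ C M x a b
  complement  : x < M → a ≤ δ → b ≤ δ → a + b + x ≡ C ∸ 1 → 𝔽-View δ C M x a b
  differenceˡ : M ≤ x → a ≤ δ → a ≡ b + x → 𝔽-View δ C M x a b
  differenceʳ : M ≤ x → b ≤ δ → b ≡ a + x → 𝔽-View δ C M x a b

inRangeᵇ-sound : ∀ δ a → T (inRangeᵇ δ a) → 1 ≤ a × a ≤ δ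
inRangeᵇ-sound δ a h with 1≤a , a≤δ ← Equivalence.to T-∧ h = ≤ᵇ⇒≤ 1 a 1≤a , ≤ᵇ⇒≤ a δ a≤δ

𝔽-view : ∀ δ C M x a b → T (𝔽 δ C M x a b) → 𝔽-View δ C M x a b
𝔽-view δ C M x a b h
  with a∈ , h′ ← Equivalence.to T-∧ h
  with b∈ , rel ← Equivalence.to T-∧ h′
  with (1≤a , a≤δ) ← inRangeᵇ-sound δ a a∈ | (1≤b , b≤δ) ← inRangeᵇ-sound δ b b∈
  with x <ᵇ M | <ᵇ-reflects-< x M
... | true  | ofʸ x<M =
  [ sum x<M 1≤a 1≤b ∘ ≡ᵇ⇒≡ _ _ , complement x<M a≤δ b≤δ ∘ ≡ᵇ⇒≡ _ _ ]′ (Equivalence.to T-∨ rel)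
... | false | ofⁿ x≮M =
  [ differenceˡ (≮⇒≥ x≮M) a≤δ ∘ ≡ᵇ⇒≡ _ _ , differenceʳ (≮⇒≥ x≮M) b≤δ ∘ ≡ᵇ⇒≡ _ _ ]′ (Equivalence.to T-∨ rel)

pairOK-inv : ∀ F {ma mb} → T (pairOK F ma mb) → ∃₂ λ a b → ma ≡ just a × mb ≡ just b × T (F a b)
pairOK-inv F {just a} {just b} Fab = a , b , refl , refl , Fab
pairOK-inv F {just _} {nothing} ()
pairOK-inv F {nothing}          ()

FCompletion-inv : ∀ {n} F c (l : Lab n) u v {k} → FCompletion F c l u v ≡ just k →
  l u v ≡ just k ⊎
  (k ≡ c × u ≢ v × Σ (Fin n) λ w → ∃₂ λ a b → l u w ≡ just a × l v w ≡ just b × T (F a b))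
FCompletion-inv {n} F c l u v h with l u v
... | just _ = inj₁ h
... | nothing with u ≟ v | any (λ w → pairOK F (l u w) (l v w)) (allFin n) in found
...   | yes _   | _     = contradiction h λ ()
...   | no _    | false = contradiction h λ ()
...   | no u≢v  | true with refl ← h =
  let w , Fw = satisfied (any⁻ _ (allFin n) (subst T (sym found) tt))
  in inj₂ (refl , u≢v , w , pairOK-inv F Fw)

module _ {n} (δ C M : ℕ) (Inv : Lab n → Set)
  (FCompletion-preserves : ∀ x → x ≢ M → ∀ l → Inv l → Inv (FCompletion (𝔽 δ C M x) x l)) where

  step-preserves : ∀ k l → Inv l → Inv (step δ C M k l)
  step-preserves k l inv = go (map suc (upTo δ))
    where
    go : ∀ xs → Inv (foldr (λ x acc → if not (x ≡ᵇ M) ∧ (tM δ M x ≡ᵇ k)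
                                      then FCompletion (𝔽 δ C M x) x acc else acc) l xs)
    go []       = inv
    go (x ∷ xs) with x ≡ᵇ M in x≡ᵇM | tM δ M x ≡ᵇ k
    ... | true  | _     = go xs
    ... | false | false = go xs
    ... | false | true  = FCompletion-preserves x (λ x≡M → subst T x≡ᵇM (≡⇒≡ᵇ x M x≡M)) _ (go xs)

  Gseq-preserves : ∀ l → Inv l → ∀ j → Inv (Gseq δ C M l j)
  Gseq-preserves l inv zero    = inv
  Gseq-preserves l inv (suc j) = step-preserves (suc j) _ (Gseq-preserves l inv j)

module Parameters {δ K₁ K₂ C₀ C₁ M : ℕ}
  (admissible : Admissible δ K₁ K₂ C₀ C₁) (magic : MagicParameter δ K₁ K₂ C₀ C₁ M) where

  open ≤-Reasoning

  C : ℕ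
  C = Cmin C₀ C₁

  private
    acceptable : Acceptable δ K₁ K₂ C₀ C₁
    acceptable = proj₁ admissible

  3≤δ : 3 ≤ δ
  3≤δ = proj₁ acceptable

  1≤K₁ : 1 ≤ K₁
  1≤K₁ = proj₁ (proj₂ acceptable)

  C₀-even : C₀ % 2 ≡ 0
  C₀-even = let (_ , _ , _ , _ , _ , _ , _ , _ , even , _) = acceptable in even

  C₁-odd : C₁ % 2 ≡ 1
  C₁-odd = let (_ , _ , _ , _ , _ , _ , _ , _ , _ , odd) = acceptable in odd

  δ<C : δ < C
  δ<C = let (_ , _ , _ , _ , 2δ+2≤C₀ , _ , 2δ+2≤C₁ , _) = acceptable in begin
    suc δ                 ≤⟨ m≤m+n (suc δ) (δ + 1) ⟩
    suc δ + (δ + 1)       ≡⟨ shape δ ⟩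
    2 * δ + 2             ≤⟨ ⊓-glb 2δ+2≤C₀ 2δ+2≤C₁ ⟩
    C                     ∎
    where
    shape : ∀ d → suc d + (d + 1) ≡ 2 * d + 2
    shape = solve-∀

  K₁≤M : K₁ ≤ M
  K₁≤M = ≤-trans (m≤m⊔n K₁ ⌈ δ /2⌉) (proj₁ (proj₁ magic))

  M≤K₂ : M ≤ K₂
  M≤K₂ = ≤-trans (proj₂ (proj₁ magic)) (m⊓n≤m K₂ _)

  1≤M : 1 ≤ M
  1≤M = ≤-trans 1≤K₁ K₁≤M

  δ≤M+M : δ ≤ M + M
  δ≤M+M = begin
    δ                   ≡⟨ sym (⌊n/2⌋+⌈n/2⌉≡n δ) ⟩
    ⌊ δ /2⌋ + ⌈ δ /2⌉   ≤⟨ +-mono-≤ (≤-trans (⌊n/2⌋≤⌈n/2⌉ δ) ⌈δ/2⌉≤M) ⌈δ/2⌉≤M ⟩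
    M + M               ∎
    where
    ⌈δ/2⌉≤M : ⌈ δ /2⌉ ≤ M
    ⌈δ/2⌉≤M = ≤-trans (m≤n⊔m K₁ ⌈ δ /2⌉) (proj₁ (proj₁ magic))

  M+M+δ<C : M + M + δ < C
  M+M+δ<C = begin
    suc (M + M + δ)     ≡⟨ cong suc (+-comm (M + M) δ) ⟩
    suc δ + (M + M)     ≡⟨ +-comm (suc δ) (M + M) ⟩
    M + M + suc δ       ≤⟨ m≤o∸n⇒m+n≤o (M + M) δ<C M+M≤C∸[1+δ] ⟩
    C                   ∎
    where
    k : ℕ
    k = C ∸ δ ∸ 1
    M≤⌊k/2⌋ : M ≤ ⌊ k /2⌋
    M≤⌊k/2⌋ = ≤-trans (proj₂ (proj₁ magic)) (m⊓n≤n K₂ _)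
    M+M≤C∸[1+δ] : M + M ≤ C ∸ suc δ
    M+M≤C∸[1+δ] = begin
      M + M               ≤⟨ +-mono-≤ M≤⌊k/2⌋ M≤⌊k/2⌋ ⟩
      ⌊ k /2⌋ + ⌊ k /2⌋   ≤⟨ +-monoʳ-≤ ⌊ k /2⌋ (⌊n/2⌋≤⌈n/2⌉ k) ⟩
      ⌊ k /2⌋ + ⌈ k /2⌉   ≡⟨ ⌊n/2⌋+⌈n/2⌉≡n k ⟩
      k                   ≡⟨ ∸-+-assoc C δ 1 ⟩
      C ∸ (δ + 1)         ≡⟨ cong (C ∸_) (+-comm δ 1) ⟩
      C ∸ suc δ           ∎

  caseIII-gap⇒2δ+M<C : CaseIII δ K₁ K₂ C₀ C₁ → C + 1 < Cmax C₀ C₁ → 2 * δ + M < C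
  caseIII-gap⇒2δ+M<C iii gap = ≰⇒> C≰2δ+M
    where
    2δ+K₂≤C : 2 * δ + K₂ ≤ C
    2δ+K₂≤C = let (_ , _ , _ , _ , bound) = iii in bound gap
    C≰2δ+M : C ≰ 2 * δ + M
    C≰2δ+M C≤2δ+M = <-irrefl M≡K₂ (proj₂ (proj₂ magic) iii gap C≡2δ+K₂)
      where
      M≡K₂ : M ≡ K₂
      M≡K₂ = ≤-antisym M≤K₂ (+-cancelˡ-≤ (2 * δ) K₂ M (≤-trans 2δ+K₂≤C C≤2δ+M))
      C≡2δ+K₂ : C ≡ 2 * δ + K₂
      C≡2δ+K₂ = ≤-antisym (subst (λ k → C ≤ 2 * δ + k) M≡K₂ C≤2δ+M) 2δ+K₂≤C

  caseIIB⇒M≡K₂ : CaseIIB δ K₁ K₂ C₀ C₁ → M ≡ K₂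
  caseIIB⇒M≡K₂ (_ , _ , K₁≡K₂ , _) = ≤-antisym M≤K₂ (subst (_≤ M) K₁≡K₂ K₁≤M)

  caseIIB⇒3M+1≡2δ : CaseIIB δ K₁ K₂ C₀ C₁ → 3 * M + 1 ≡ 2 * δ
  caseIIB⇒3M+1≡2δ iib@(_ , _ , _ , 3K₂≡2δ∸1) = begin-equality
    3 * M + 1       ≡⟨ cong (λ k → 3 * k + 1) (caseIIB⇒M≡K₂ iib) ⟩
    3 * K₂ + 1      ≡⟨ cong (_+ 1) 3K₂≡2δ∸1 ⟩
    2 * δ ∸ 1 + 1   ≡⟨ m∸n+n≡m 1≤2δ ⟩
    2 * δ           ∎
    where
    1≤2δ : 1 ≤ 2 * δ
    1≤2δ = ≤-trans (≤-trans (s≤s z≤n) 3≤δ) (m≤m+n δ (1 * δ))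

  caseIIB⇒C≡4M+1 : CaseIIB δ K₁ K₂ C₀ C₁ → C ≡ 4 * M + 1
  caseIIB⇒C≡4M+1 iib@((_ , C≡2K₁+2K₂+1 , _) , _ , K₁≡K₂ , _) = begin-equality
    C                       ≡⟨ C≡2K₁+2K₂+1 ⟩
    2 * K₁ + 2 * K₂ + 1     ≡⟨ cong₂ (λ k k′ → 2 * k + 2 * k′ + 1) (trans K₁≡K₂ (sym M≡K₂)) (sym M≡K₂) ⟩
    2 * M + 2 * M + 1       ≡⟨ shape M ⟩
    4 * M + 1               ∎
    where
    M≡K₂ : M ≡ K₂
    M≡K₂ = caseIIB⇒M≡K₂ iib
    shape : ∀ m → 2 * m + 2 * m + 1 ≡ 4 * m + 1
    shape = solve-∀

  caseIIB⇒δ<M+M : CaseIIB δ K₁ K₂ C₀ C₁ → δ < M + M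
  caseIIB⇒δ<M+M iib = ≰⇒> M+M≰δ
    where
    M+M≰δ : M + M ≰ δ
    M+M≰δ M+M≤δ = 6≰4 (begin
      6           ≤⟨ *-monoʳ-≤ 2 3≤δ ⟩
      2 * δ       ≡⟨ sym (caseIIB⇒3M+1≡2δ iib) ⟩
      3 * M + 1   ≤⟨ +-monoˡ-≤ 1 (*-monoʳ-≤ 3 M≤1) ⟩
      4           ∎)
      where
      6≰4 : 6 ≰ 4
      6≰4 (s≤s (s≤s (s≤s (s≤s ()))))
      shape : ∀ m → 3 * m + m ≡ (m + m) + (m + m)
      shape = solve-∀
      M≤1 : M ≤ 1
      M≤1 = +-cancelˡ-≤ (3 * M) M 1 (begin
        3 * M + M           ≡⟨ shape M ⟩
        (M + M) + (M + M)   ≤⟨ +-mono-≤ M+M≤δ M+M≤δ ⟩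
        δ + δ               ≡⟨ cong (δ +_) (sym (+-identityʳ δ)) ⟩
        2 * δ               ≡⟨ sym (caseIIB⇒3M+1≡2δ iib) ⟩
        3 * M + 1           ∎)

  Between : ℕ → ℕ → Set
  Between l D =
    (D ≥ l × l ≥ M) ⊎
    (D ≤ l × l ≤ M) ⊎
    (CaseIIB δ K₁ K₂ C₀ C₁ × l ≡ M ∸ 1 × M < D × D % 2 ≡ l % 2)

  Between-refl : ∀ l → Between l l
  Between-refl l with ≤-total l M
  ... | inj₁ l≤M = inj₂ (inj₁ (≤-refl , l≤M))
  ... | inj₂ M≤l = inj₁ (≤-refl , M≤l)

  Between-M : ∀ D → Between M D
  Between-M D with ≤-total D M
  ... | inj₁ D≤M = inj₂ (inj₁ (D≤M , ≤-refl))
  ... | inj₂ M≤D = inj₁ (M≤D , ≤-refl)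

  l≡M∸1⇒1+l≡M : ∀ {l} → l ≡ M ∸ 1 → suc l ≡ M
  l≡M∸1⇒1+l≡M l≡M∸1 = trans (cong suc l≡M∸1) (m+[n∸m]≡n 1≤M)

  M<l⇒l≤D : ∀ {l D} → M < l → Between l D → l ≤ D
  M<l⇒l≤D M<l (inj₁ (l≤D , _))                 = l≤D
  M<l⇒l≤D M<l (inj₂ (inj₁ (_ , l≤M)))          = contradiction l≤M (<⇒≱ M<l)
  M<l⇒l≤D M<l (inj₂ (inj₂ (_ , l≡M∸1 , _)))    =
    contradiction (subst (_≤ M) (sym l≡M∸1) (m∸n≤m M 1)) (<⇒≱ M<l)

  1+l<M⇒D≤l : ∀ {l D} → suc l < M → Between l D → D ≤ l
  1+l<M⇒D≤l 1+l<M (inj₁ (_ , M≤l))              = contradiction (≤-trans M≤l (n≤1+n _)) (<⇒≱ 1+l<M)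
  1+l<M⇒D≤l 1+l<M (inj₂ (inj₁ (D≤l , _)))       = D≤l
  1+l<M⇒D≤l 1+l<M (inj₂ (inj₂ (_ , l≡M∸1 , _))) =
    ⊥-elim (<-irrefl (l≡M∸1⇒1+l≡M l≡M∸1) 1+l<M)

  l+M<δ⇒D≤l : ∀ {l D} → l + M < δ → Between l D → D ≤ l
  l+M<δ⇒D≤l l+M<δ (inj₁ (_ , M≤l))              =
    contradiction (≤-trans δ≤M+M (+-monoˡ-≤ M M≤l)) (<⇒≱ l+M<δ)
  l+M<δ⇒D≤l l+M<δ (inj₂ (inj₁ (D≤l , _)))       = D≤l
  l+M<δ⇒D≤l {l} l+M<δ (inj₂ (inj₂ (iib , l≡M∸1 , _))) =
    contradiction (subst (λ k → k + M ≤ δ) (l≡M∸1⇒1+l≡M l≡M∸1) l+M<δ) (<⇒≱ (caseIIB⇒δ<M+M iib))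

  sum-edge : ∀ {x a b D A B} → x < M → 1 ≤ a → 1 ≤ b → a + b ≡ x →
    Between a A → Between b B → D ≤ A + B → Between x D
  sum-edge {x} {a} {b} {D} {A} {B} x<M 1≤a 1≤b a+b≡x a~A b~B D≤A+B =
    inj₂ (inj₁ (D≤x , <⇒≤ x<M))
    where
    1+a<M : suc a < M
    1+a<M = ≤-<-trans (subst (suc a ≤_) a+b≡x (subst (_≤ a + b) (+-comm a 1) (+-monoʳ-≤ a 1≤b))) x<M
    1+b<M : suc b < M
    1+b<M = ≤-<-trans (subst (suc b ≤_) a+b≡x (+-monoˡ-≤ b 1≤a)) x<M
    D≤x : D ≤ x
    D≤x = begin
      D       ≤⟨ D≤A+B ⟩
      A + B   ≤⟨ +-mono-≤ (1+l<M⇒D≤l 1+a<M a~A) (1+l<M⇒D≤l 1+b<M b~B) ⟩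
      a + b   ≡⟨ a+b≡x ⟩
      x       ∎

  difference-edge : ∀ {x a b D A B} → M < x → a ≤ δ → a ≡ b + x →
    Between a A → Between b B → A ≤ D + B → Between x D
  difference-edge {x} {a} {b} {D} {A} {B} M<x a≤δ a≡b+x a~A b~B A≤D+B =
    inj₁ (x≤D , <⇒≤ M<x)
    where
    b+M<δ : b + M < δ
    b+M<δ = begin-strict
      b + M   <⟨ +-monoʳ-< b M<x ⟩
      b + x   ≡⟨ sym a≡b+x ⟩
      a       ≤⟨ a≤δ ⟩
      δ       ∎
    M<a : M < a
    M<a = <-≤-trans M<x (subst (x ≤_) (sym a≡b+x) (m≤n+m x b))
    x≤D : x ≤ D
    x≤D = +-cancelˡ-≤ b x D (begin
      b + x   ≡⟨ sym a≡b+x ⟩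
      a       ≤⟨ M<l⇒l≤D M<a a~A ⟩
      A       ≤⟨ A≤D+B ⟩
      D + B   ≤⟨ +-monoʳ-≤ D (l+M<δ⇒D≤l b+M<δ b~B) ⟩
      D + b   ≡⟨ +-comm D b ⟩
      b + D   ∎)

  complement-sum : ∀ {a b x} → a + b + x ≡ C ∸ 1 → a + b + suc x ≡ C
  complement-sum {a} {b} {x} e =
    trans (+-suc (a + b) x) (trans (cong suc e) (m+[n∸m]≡n (≤-trans (s≤s z≤n) δ<C)))

  complement-long : ∀ {a b x} → b ≤ δ → x < M → a + b + suc x ≡ C → M < a
  complement-long {a} {b} {x} b≤δ x<M a+b+1+x≡C = +-cancelʳ-≤ (M + δ) (suc M) a (begin
    suc M + (M + δ)     ≡⟨ cong suc (sym (+-assoc M M δ)) ⟩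
    suc (M + M + δ)     ≤⟨ M+M+δ<C ⟩
    C                   ≡⟨ sym a+b+1+x≡C ⟩
    a + b + suc x       ≤⟨ +-mono-≤ (+-monoʳ-≤ a b≤δ) x<M ⟩
    a + δ + M           ≡⟨ shape a δ M ⟩
    a + (M + δ)         ∎)
    where
    shape : ∀ a d m → a + d + m ≡ a + (m + d)
    shape = solve-∀

  caseIIB-complement : ∀ {a b x} → CaseIIB δ K₁ K₂ C₀ C₁ → a ≤ δ → b ≤ δ → x < M →
    a + b + suc x ≡ C → suc x ≡ M × a ≡ δ × b ≡ δ
  caseIIB-complement {a} {b} {x} iib a≤δ b≤δ x<M a+b+1+x≡C =
    1+x≡M , m+n≡o+o⇒m≡o a≤δ b≤δ a+b≡δ+δ , m+n≡o+o⇒m≡o b≤δ a≤δ (trans (+-comm b a) a+b≡δ+δ)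
    where
    shape : ∀ m → 4 * m + 1 ≡ (3 * m + 1) + m
    shape = solve-∀
    δ+δ≡3M+1 : δ + δ ≡ 3 * M + 1
    δ+δ≡3M+1 = trans (cong (δ +_) (sym (+-identityʳ δ))) (sym (caseIIB⇒3M+1≡2δ iib))
    C≡3M+1+M : C ≡ (3 * M + 1) + M
    C≡3M+1+M = trans (caseIIB⇒C≡4M+1 iib) (shape M)
    1+x≡M : suc x ≡ M
    1+x≡M = ≤-antisym x<M (+-cancelˡ-≤ (3 * M + 1) M (suc x) (begin
      (3 * M + 1) + M     ≡⟨ sym C≡3M+1+M ⟩
      C                   ≡⟨ sym a+b+1+x≡C ⟩
      a + b + suc x       ≤⟨ +-monoˡ-≤ (suc x) (+-mono-≤ a≤δ b≤δ) ⟩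
      δ + δ + suc x       ≡⟨ cong (_+ suc x) δ+δ≡3M+1 ⟩
      (3 * M + 1) + suc x ∎))
    a+b≡δ+δ : a + b ≡ δ + δ
    a+b≡δ+δ = +-cancelʳ-≡ M (a + b) (δ + δ) (begin-equality
      a + b + M           ≡⟨ cong (a + b +_) (sym 1+x≡M) ⟩
      a + b + suc x       ≡⟨ a+b+1+x≡C ⟩
      C                   ≡⟨ C≡3M+1+M ⟩
      (3 * M + 1) + M     ≡⟨ cong (_+ M) (sym δ+δ≡3M+1) ⟩
      δ + δ + M           ∎)

  caseIIB-long-complement-edge : ∀ {x a b D A B} → CaseIIB δ K₁ K₂ C₀ C₁ →
    x < M → x < D → a ≤ δ → b ≤ δ → a + b + suc x ≡ C →
    a ≤ A → A ≤ δ → b ≤ B → B ≤ δ → (D + B + A) % 2 ≢ C % 2 →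
    x ≡ M ∸ 1 × M < D × D % 2 ≡ x % 2
  caseIIB-long-complement-edge {x} {a} {b} {D} {A} {B}
    iib x<M x<D a≤δ b≤δ a+b+1+x≡C a≤A A≤δ b≤B B≤δ perimeter≢C =
    cong (_∸ 1) 1+x≡M , M<D , D≡x
    where
    forced : suc x ≡ M × a ≡ δ × b ≡ δ
    forced = caseIIB-complement iib a≤δ b≤δ x<M a+b+1+x≡C
    1+x≡M : suc x ≡ M
    1+x≡M = proj₁ forced
    a≡δ : a ≡ δ
    a≡δ = proj₁ (proj₂ forced)
    b≡δ : b ≡ δ
    b≡δ = proj₂ (proj₂ forced)
    D≢1+x : D % 2 ≢ suc x % 2
    D≢1+x D≡1+x = perimeter≢C (begin-equality
      (D + B + A) % 2       ≡⟨ cong₂ (λ k k′ → (D + k + k′) % 2) B≡δ A≡δ ⟩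
      (D + δ + δ) % 2       ≡⟨ [m+n+n]%2≡m%2 D δ ⟩
      D % 2                 ≡⟨ D≡1+x ⟩
      suc x % 2             ≡⟨ sym ([m+n+n]%2≡m%2 (suc x) δ) ⟩
      (suc x + δ + δ) % 2   ≡⟨ cong (_% 2) (trans (+-assoc (suc x) δ δ) (+-comm (suc x) (δ + δ))) ⟩
      (δ + δ + suc x) % 2   ≡⟨ cong₂ (λ k k′ → (k + k′ + suc x) % 2) (sym a≡δ) (sym b≡δ) ⟩
      (a + b + suc x) % 2   ≡⟨ cong (_% 2) a+b+1+x≡C ⟩
      C % 2                 ∎)
      where
      A≡δ : A ≡ δ
      A≡δ = ≤-antisym A≤δ (subst (_≤ A) a≡δ a≤A)
      B≡δ : B ≡ δ
      B≡δ = ≤-antisym B≤δ (subst (_≤ B) b≡δ b≤B)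
    D≡x : D % 2 ≡ x % 2
    D≡x = %2≢suc%2⇒≡ D x D≢1+x
    M<D : M < D
    M<D = subst (_< D) 1+x≡M (≤∧≢⇒< x<D (λ 1+x≡D → %2-suc≢ x (trans (cong (_% 2) 1+x≡D) D≡x)))

  -- If d′ exceeds x, the perimeter reaches C; the parity bounds allow that only when
  -- C′ > C + 1, which rules out Case (IIA), and Case (III) by the choice of M.
  complement-edge : ∀ {x a b D A B} → x < M → a ≤ δ → b ≤ δ → a + b + x ≡ C ∸ 1 →
    Between a A → Between b B → A ≤ δ → B ≤ δ →
    ((D + B + A) % 2 ≡ 1 → D + B + A < C₁) → ((D + B + A) % 2 ≡ 0 → D + B + A < C₀) →
    Between x D
  complement-edge {x} {a} {b} {D} {A} {B} x<M a≤δ b≤δ e a~A b~B A≤δ B≤δ odd⇒ even⇒ with D ≤? x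
  ... | yes D≤x = inj₂ (inj₁ (D≤x , <⇒≤ x<M))
  ... | no D≰x =
    [ [ (λ (_ , C′≡C+1) → contradiction gap (<-irrefl (sym C′≡C+1)))
      , (λ iib → inj₂ (inj₂ (iib , caseIIB-long-complement-edge iib x<M x<D a≤δ b≤δ
                                     a+b+1+x≡C a≤A A≤δ b≤B B≤δ (proj₂ perimeter-gap′)))) ]′
    , (λ iii → contradiction C≤2δ+M (<⇒≱ (caseIII-gap⇒2δ+M<C iii gap))) ]′
    (proj₂ admissible)
    where
    x<D : x < D
    x<D = ≰⇒> D≰x
    a+b+1+x≡C : a + b + suc x ≡ C
    a+b+1+x≡C = complement-sum {a} {b} e
    a≤A : a ≤ A
    a≤A = M<l⇒l≤D (complement-long b≤δ x<M a+b+1+x≡C) a~A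
    b≤B : b ≤ B
    b≤B = M<l⇒l≤D (complement-long a≤δ x<M (trans (cong (_+ suc x) (+-comm b a)) a+b+1+x≡C)) b~B
    shape : ∀ a b x → a + b + x ≡ x + b + a
    shape = solve-∀
    C≤perimeter : C ≤ D + B + A
    C≤perimeter = begin
      C               ≡⟨ sym a+b+1+x≡C ⟩
      a + b + suc x   ≡⟨ shape a b (suc x) ⟩
      suc x + b + a   ≤⟨ +-mono-≤ (+-mono-≤ x<D b≤B) a≤A ⟩
      D + B + A       ∎
    perimeter-gap′ : C + 1 < Cmax C₀ C₁ × (D + B + A) % 2 ≢ C % 2
    perimeter-gap′ = perimeter-gap C₀-even C₁-odd C≤perimeter odd⇒ even⇒
    gap : C + 1 < Cmax C₀ C₁
    gap = proj₁ perimeter-gap′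
    C≤2δ+M : C ≤ 2 * δ + M
    C≤2δ+M = begin
      C               ≡⟨ sym a+b+1+x≡C ⟩
      a + b + suc x   ≤⟨ +-mono-≤ (+-mono-≤ a≤δ b≤δ) x<M ⟩
      δ + δ + M       ≡⟨ cong (λ k → δ + k + M) (sym (+-identityʳ δ)) ⟩
      2 * δ + M       ∎

  module _ {n} (G : ELGraph δ n) {d′ : Fin n → Fin n → ℕ}
    (completion : CompletionInA δ K₁ K₂ C₀ C₁ n G d′) where

    private
      module d′ = IsMetricδ (proj₁ (proj₁ completion))

      uv≤uw+vw : ∀ u v w → d′ u v ≤ d′ u w + d′ v w
      uv≤uw+vw u v w = subst (λ k → d′ u v ≤ d′ u w + k) (d′.symm w v) (d′.triangle u w v)

      vw≤uv+uw : ∀ u v w → d′ v w ≤ d′ u v + d′ u w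
      vw≤uv+uw u v w = subst (λ k → d′ v w ≤ k + d′ u w) (d′.symm v u) (d′.triangle v u w)

      odd-perimeter<C₁ : ∀ {u v w} → u ≢ v → v ≢ w → u ≢ w →
        (d′ u v + d′ v w + d′ u w) % 2 ≡ 1 → d′ u v + d′ v w + d′ u w < C₁
      odd-perimeter<C₁ u≢v v≢w u≢w odd =
        proj₂ (proj₂ (proj₁ (proj₂ (proj₁ completion) _ _ _ u≢v v≢w u≢w) odd))

      even-perimeter<C₀ : ∀ {u v w} → u ≢ v → v ≢ w → u ≢ w →
        (d′ u v + d′ v w + d′ u w) % 2 ≡ 0 → d′ u v + d′ v w + d′ u w < C₀
      even-perimeter<C₀ u≢v v≢w u≢w = proj₂ (proj₂ (proj₁ completion) _ _ _ u≢v v≢w u≢w)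

    triangle-step : ∀ {x a b u v w} → x ≢ M → u ≢ v → u ≢ w → v ≢ w → 𝔽-View δ C M x a b →
      Between a (d′ u w) → Between b (d′ v w) → Between x (d′ u v)
    triangle-step _ _ _ _ (sum x<M 1≤a 1≤b e) a~A b~B =
      sum-edge x<M 1≤a 1≤b e a~A b~B (uv≤uw+vw _ _ _)
    triangle-step _ u≢v u≢w v≢w (complement x<M a≤δ b≤δ e) a~A b~B =
      complement-edge x<M a≤δ b≤δ e a~A b~B (d′.bounded _ _) (d′.bounded _ _)
        (odd-perimeter<C₁ u≢v v≢w u≢w) (even-perimeter<C₀ u≢v v≢w u≢w)
    triangle-step x≢M _ _ _ (differenceˡ M≤x a≤δ e) a~A b~B =
      difference-edge (≤∧≢⇒< M≤x (x≢M ∘ sym)) a≤δ e a~A b~B (d′.triangle _ _ _)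
    triangle-step x≢M _ _ _ (differenceʳ M≤x b≤δ e) a~A b~B =
      difference-edge (≤∧≢⇒< M≤x (x≢M ∘ sym)) b≤δ e b~B a~A (vw≤uv+uw _ _ _)

    EdgesBetween : Lab n → Set
    EdgesBetween l = ∀ u v {k} → l u v ≡ just k → u ≢ v × Between k (d′ u v)

    lab-edges-between : EdgesBetween (lab G)
    lab-edges-between u v {k} uv≡k =
      u≢v , subst (Between k) (sym (proj₂ completion u v k uv≡k)) (Between-refl k)
      where
      u≢v : u ≢ v
      u≢v refl = contradiction (trans (sym (loopless G u)) uv≡k) λ ()

    FCompletion-edges-between : ∀ x → x ≢ M → ∀ l → EdgesBetween l →
      EdgesBetween (FCompletion (𝔽 δ C M x) x l)
    FCompletion-edges-between x x≢M l between u v h with FCompletion-inv (𝔽 δ C M x) x l u v h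
    ... | inj₁ uv≡k = between u v uv≡k
    ... | inj₂ (refl , u≢v , w , a , b , uw≡a , vw≡b , Fab)
      with u≢w , a~A ← between u w uw≡a
      with v≢w , b~B ← between v w vw≡b
      = u≢v , triangle-step x≢M u≢v u≢w v≢w (𝔽-view δ C M x a b Fab) a~A b~B

    magicCompletion-between : ∀ u v → Between (magicCompletion C₀ C₁ M G u v) (d′ u v)
    magicCompletion-between u v with Gseq δ C M (lab G) (2 * δ) u v in uv≡
    ... | just k  = proj₂ (Gseq-preserves δ C M EdgesBetween FCompletion-edges-between
                             (lab G) lab-edges-between (2 * δ) u v uv≡)
    ... | nothing with u ≟ v
    ...   | yes refl = subst (Between 0) (sym (d′.eq⇒zero u)) (Between-refl 0)
    ...   | no _     = Between-M (d′ u v)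

lemma5p11 : (δ K₁ K₂ C₀ C₁ M : ℕ) →
    Admissible δ K₁ K₂ C₀ C₁ →
    MagicParameter δ K₁ K₂ C₀ C₁ M →
    (n : ℕ) (G : ELGraph δ n) →
    (∃ λ d → CompletionInA δ K₁ K₂ C₀ C₁ n G d) →
    (d′ : Fin n → Fin n → ℕ) → CompletionInA δ K₁ K₂ C₀ C₁ n G d′ →
    (u v : Fin n) →
    let d̄ = magicCompletion C₀ C₁ M G in
    (d′ u v ≥ d̄ u v × d̄ u v ≥ M) ⊎
    (d′ u v ≤ d̄ u v × d̄ u v ≤ M) ⊎
    (CaseIIB δ K₁ K₂ C₀ C₁ × d̄ u v ≡ M ∸ 1 × M < d′ u v × d′ u v % 2 ≡ d̄ u v % 2)
lemma5p11 δ K₁ K₂ C₀ C₁ M admissible magic n G _ d′ completion =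
  Parameters.magicCompletion-between admissible magic G completion
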